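{- For every program $P$ of $\mathcal{L}(\mathcal{S})$ and every variable $a$ of $P$ there is a Past LTL formula $\varphi$ over the input variables of $P$, of size at most exponential in the size of $P$, such that for every interpretation $I$ and time point $t$, $(P,I,t)\models a$ iff $(P,I,t)\models\varphi$.
   Context: Past LTL: formulas are built from propositional variables and $\top,\bot$ using $\neg,\land,\lor$, the before operator $\ominus$ and the since operator $\mathsf{S}$; $(I,t)\models\ominus\alpha$ iff $(I,t-1)\models\alpha$; $(I,t)\models\alpha\,\mathsf{S}\,\beta$ iff there is $j\in[1,t]$ with $(I,j)\models\beta$ and $(I,k)\models\alpha$ for all $k\in[j+1,t]$; Boolean connectives and variables as usual. Programs: write $\mathbb{B}=\{0,1\}$. An operator automaton is $\mathcal{A}=\langle \mathbb{B}^m,[1,n],\delta,q_{\mathrm{init}}\rangle$ with $\delta:[1,n]\times\mathbb{B}^m\to[1,n]$. Rules: static $p \;{:}{ - }\; \alpha$ ($\alpha$ built from variables, $\top,\bot$ with $\neg,\land,\lor$); delay $p \;{:}{ - }\; \ominus q$; dynamic $p_1,\dots,p_n \;{:}{ - }\; \mathcal{A}(a_1,\dots,a_m)$. A program is a finite set of rules that is nonrecursive (the graph with an edge $a\to b$ whenever $a$ occurs in the body and $b$ in the head of a rule is acyclic) and definitorial (each variable is in at most one head). Non-defined variables are input variables; an interpretation is a finite non-empty sequence $I=I_1,\dots,I_\ell$ of subsets of input variables. Satisfaction $(P,I,t)\models\cdot$ extends the Past LTL semantics: input $a$ holds iff $a\in I_t$; $p$ defined by $p\;{:}{ - }\;\alpha$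 iff $(P,I,t)\models\alpha$; $p$ defined by $p\;{:}{ - }\;\ominus q$ iff $(P,I,t-1)\models q$; for $p_i$ defined by a dynamic rule, $(P,I,0)\models p_i$ iff $q_{\mathrm{init}}=i$, and for $t>0$, $(P,I,t)\models p_i$ iff there are $j$ and $\sigma\in\mathbb{B}^m$ (an assignment to $a_1,\dots,a_m$, identified with the conjunction of literals it makes true) with $\delta(j,\sigma)=i$, $(P,I,t-1)\models p_j$, $(P,I,t)\models\sigma$. $\mathcal{L}(\mathcal{S})$ is the set of programs whose dynamic rules all use the operator $\mathcal{S}=\langle\mathbb{B}^2,\{1,2\},\delta,1\rangle$ with $\delta(q,10)=q$, $\delta(q,01)=\delta(q,11)=2$, $\delta(q,00)=1$. -}

module Defs where

open import Data.Nat using (ℕ; zero; suc; _+_; _*_; _^_; _≤_)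
open import Data.Bool using (Bool; true; false; T)
open import Data.Fin using (Fin; zero; suc)
open import Data.List using (List; []; _∷_; _++_; concatMap; length; lookup)
open import Data.List.Membership.Propositional using (_∈_; _∉_)
open import Data.List.Relation.Unary.Unique.Propositional using (Unique)
open import Data.Product using (Σ; ∃; _×_; _,_)
open import Data.Sum using (_⊎_)
open import Data.Empty using (⊥)
open import Data.Unit using (⊤)
open import Relation.Nullary using (¬_)
open import Relation.Binary.PropositionalEquality using (_≡_)
open import Relation.Binary.Construct.Closure.Transitive using (TransClosure)
open import Function.Bundles using (_⇔_)

Var : Set
Var = ℕ

data Formula : Set where
  var   : Var → Formula
  tt ff : Formula
  ¬ᶠ_   : Formula → Formula
  _∧ᶠ_  : Formula → Formula → Formula
  _∨ᶠ_  : Formula → Formula → Formula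
  ⊖_    : Formula → Formula
  _Sᶠ_  : Formula → Formula → Formula

fsize : Formula → ℕ
fsize (var _)  = 1
fsize tt       = 1
fsize ff       = 1
fsize (¬ᶠ α)   = suc (fsize α)
fsize (α ∧ᶠ β) = suc (fsize α + fsize β)
fsize (α ∨ᶠ β) = suc (fsize α + fsize β)
fsize (⊖ α)    = suc (fsize α)
fsize (α Sᶠ β) = suc (fsize α + fsize β)

fvars : Formula → List Var
fvars (var x)  = x ∷ []
fvars tt       = []
fvars ff       = []
fvars (¬ᶠ α)   = fvars α
fvars (α ∧ᶠ β) = fvars α ++ fvars β
fvars (α ∨ᶠ β) = fvars α ++ fvars β
fvars (⊖ α)    = fvars α
fvars (α Sᶠ β) = fvars α ++ fvars β

-- An interpretation I = I₁,…,I_ℓ : a finite non-empty list of sets of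
-- variables, each set given by its (decidable) characteristic function.
Interp : Set
Interp = List (Var → Bool)

NonEmpty : Interp → Set
NonEmpty [] = ⊥
NonEmpty (_ ∷ _) = ⊤

-- I_t for t ≥ 1 (time points are 1-based); empty outside [1,ℓ].
at : Interp → ℕ → Var → Bool
at I zero _ = false
at [] (suc t) _ = false
at (s ∷ I) (suc zero) x = s x
at (s ∷ I) (suc (suc t)) x = at I (suc t) x

-- (I,t) ⊨ φ.  Convention: nothing holds at time point 0
-- (so ⊖α is false at time 1).
_,_⊨_ : Interp → ℕ → Formula → Set
I , zero  ⊨ φ = ⊥
I , suc t ⊨ var x    = at I (suc t) x ≡ true
I , suc t ⊨ tt       = ⊤
I , suc t ⊨ ff       = ⊥
I , suc t ⊨ (¬ᶠ α)   = ¬ (I , suc t ⊨ α)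
I , suc t ⊨ (α ∧ᶠ β) = (I , suc t ⊨ α) × (I , suc t ⊨ β)
I , suc t ⊨ (α ∨ᶠ β) = (I , suc t ⊨ α) ⊎ (I , suc t ⊨ β)
I , suc t ⊨ (⊖ α)    = I , t ⊨ α
I , suc t ⊨ (α Sᶠ β) =
  Σ ℕ λ j → (1 ≤ j) × (j ≤ suc t) × (I , j ⊨ β)
          × (∀ k → suc j ≤ k → k ≤ suc t → I , k ⊨ α)

-- The operator automaton 𝒮 = ⟨𝔹², {1,2}, δ, 1⟩.
-- State 1 is 'zero', state 2 is 'suc zero'.  δ q a₁ a₂.

δS : Fin 2 → Bool → Bool → Fin 2
δS q true  false = q
δS q false true  = suc zero
δS q true  true  = suc zero
δS q false false = zero

qinit : Fin 2
qinit = zero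

data SFormula : Set where
  var   : Var → SFormula
  tt ff : SFormula
  ¬ˢ_   : SFormula → SFormula
  _∧ˢ_  : SFormula → SFormula → SFormula
  _∨ˢ_  : SFormula → SFormula → SFormula

ssize : SFormula → ℕ
ssize (var _)  = 1
ssize tt       = 1
ssize ff       = 1
ssize (¬ˢ α)   = suc (ssize α)
ssize (α ∧ˢ β) = suc (ssize α + ssize β)
ssize (α ∨ˢ β) = suc (ssize α + ssize β)

svars : SFormula → List Var
svars (var x)  = x ∷ []
svars tt       = []
svars ff       = []
svars (¬ˢ α)   = svars α
svars (α ∧ˢ β) = svars α ++ svars β
svars (α ∨ˢ β) = svars α ++ svars β

⟦_⟧ˢ : SFormula → (Var → Bool) → Set
⟦ var x ⟧ˢ v  = v x ≡ true
⟦ tt ⟧ˢ v     = ⊤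
⟦ ff ⟧ˢ v     = ⊥
⟦ ¬ˢ α ⟧ˢ v   = ¬ ⟦ α ⟧ˢ v
⟦ α ∧ˢ β ⟧ˢ v = ⟦ α ⟧ˢ v × ⟦ β ⟧ˢ v
⟦ α ∨ˢ β ⟧ˢ v = ⟦ α ⟧ˢ v ⊎ ⟦ β ⟧ˢ v

data Rule : Set where
  static  : (p : Var) → SFormula → Rule
  delay   : (p q : Var) → Rule
  dynamic : (ps : Fin 2 → Var) (a₁ a₂ : Var) → Rule

Program : Set
Program = List Rule

heads : Rule → List Var
heads (static p _)      = p ∷ []
heads (delay p _)       = p ∷ []
heads (dynamic ps _ _)  = ps zero ∷ ps (suc zero) ∷ []

body : Rule → List Var
body (static _ α)       = svars α
body (delay _ q)        = q ∷ []
body (dynamic _ a₁ a₂)  = a₁ ∷ a₂ ∷ []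

rsize : Rule → ℕ
rsize (static _ α)  = suc (ssize α)
rsize (delay _ _)   = 2
rsize (dynamic _ _ _) = 4

psize : Program → ℕ
psize []      = 0
psize (r ∷ P) = rsize r + psize P

allHeads : Program → List Var
allHeads = concatMap heads

vars : Program → List Var
vars = concatMap (λ r → heads r ++ body r)

Edge : Program → Var → Var → Set
Edge P a b = Σ Rule λ r → r ∈ P × a ∈ body r × b ∈ heads r

NonRecursive : Program → Set
NonRecursive P = ∀ x → ¬ TransClosure (Edge P) x x

-- each variable occurs in at most one head (counting both heads of a
-- dynamic rule, which must therefore be distinct)
Definitorial : Program → Set
Definitorial P = Unique (allHeads P)

ValidProgram : Program → Set
ValidProgram P = NonRecursive P × Definitorial P

Input : Program → Var → Set
Input P x = x ∉ allHeads P

-- A function M : time → variable → Bool is the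
-- satisfaction relation (P,I,t) ⊨ x  (M t x ≡ true) iff it satisfies all
-- defining clauses below; for a nonrecursive definitorial program this
-- recursive definition has exactly one solution.
-- Convention at time 0: only dynamic heads are defined, by q_init; all
-- other variables are false at time 0.

record IsSemantics (P : Program) (I : Interp) (M : ℕ → Var → Bool) : Set where
  field
    time0-dyn   : ∀ ps a₁ a₂ → dynamic ps a₁ a₂ ∈ P → ∀ i →
                  (M 0 (ps i) ≡ true) ⇔ (qinit ≡ i)
    time0-other : ∀ x → (∀ ps a₁ a₂ i → dynamic ps a₁ a₂ ∈ P → ¬ ps i ≡ x) →
                  M 0 x ≡ false
    input       : ∀ t x → Input P x → M (suc t) x ≡ at I (suc t) x
    static-rule : ∀ t p α → static p α ∈ P →
                  (M (suc t) p ≡ true) ⇔ ⟦ α ⟧ˢ (M (suc t))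
    delay-rule  : ∀ t p q → delay p q ∈ P → M (suc t) p ≡ M t q
    dyn-rule    : ∀ t ps a₁ a₂ → dynamic ps a₁ a₂ ∈ P → ∀ i →
                  (M (suc t) (ps i) ≡ true) ⇔
                  (Σ (Fin 2) λ j → (δS j (M (suc t) a₁) (M (suc t) a₂) ≡ i)
                                   × (M t (ps j) ≡ true))

{-# OPTIONS --safe #-}

-- Unfold every variable along the rule defining it until only inputs remain: a static
-- rule becomes its body, a delay p :- ⊖q becomes ⊖q (corrected at time 1 by the constant
-- value q takes at time 0), and the heads p₁, p₂ of a rule 𝒮(a₁,a₂) become ¬(a₁ S a₂) and
-- a₁ S a₂, since 𝒮 is in state 2 exactly when a₂ has held at some point and a₁ at every
-- later one.  Each rule is discarded once unfolded, so the unfolding terminates; a variable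
-- no remaining rule defines is an input because P is nonrecursive.  A rule of size s
-- multiplies the size bound by at most 4^s, whence |φ| ≤ 4^(1+|P|) = 2^(2(1+|P|)).

module Submission where

open import Defs
open import Data.Nat using (ℕ; zero; suc; _+_; _*_; _^_; _≤_; _<_; z≤n; s≤s; _≟_)
open import Data.Nat.Properties
open import Algebra.Properties.CommutativeSemigroup +-commutativeSemigroup using (x∙yz≈y∙xz)
open import Data.Bool using (Bool; true; false)
open import Data.Bool.Properties using (¬-not)
open import Data.Fin using (Fin; zero; suc)
open import Data.List using (List; []; _∷_; length; map)
open import Data.List.Properties using (length-removeAt′)
open import Data.List.Membership.Propositional using (_∈_; find; lose)
open import Data.List.Membership.Propositional.Properties using (∈-concat⁻)
open import Data.List.Membership.DecPropositional _≟_ using (_∈?_)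
open import Data.List.Relation.Unary.Any using (here; there; any?; _─_; index)
import Data.List.Relation.Unary.Any.Properties as Any
open import Data.List.Relation.Unary.All using (All; []; _∷_)
import Data.List.Relation.Unary.All as All
import Data.List.Relation.Unary.All.Properties as All
open import Data.List.Relation.Binary.Subset.Propositional using (_⊆_)
open import Data.Product using (Σ; ∃; _×_; _,_)
open import Data.Product.Function.NonDependent.Propositional using (_×-⇔_)
open import Data.Sum using (_⊎_; inj₁; inj₂)
import Data.Sum as Sum
open import Data.Sum.Function.Propositional using (_⊎-⇔_)
open import Data.Empty using (⊥; ⊥-elim)
open import Data.Unit using (⊤)
open import Relation.Nullary using (¬_; Dec; yes; no)
open import Relation.Nullary.Decidable using (⌊_⌋; map′)
open import Relation.Binary.PropositionalEquality using (_≡_; refl; sym; trans; cong; subst)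
open import Relation.Binary.Construct.Closure.Transitive using (TransClosure; [_]; _∷_)
open import Relation.Binary.Construct.Closure.ReflexiveTransitive using (Star; ε; _◅_)
open import Function using (_∘_; id)
open import Function.Bundles using (_⇔_; mk⇔; Equivalence)
open import Function.Construct.Identity using (⇔-id)
open import Function.Construct.Symmetry using (⇔-sym)
open import Function.Construct.Composition using (_⇔-∘_)
open import Function.Related.Propositional using (module EquationalReasoning)
open import Function.Related.TypeIsomorphisms using (¬-cong-⇔)

open Equivalence using (to; from)

Since : (ℕ → Set) → (ℕ → Set) → ℕ → Set
Since A B t = Σ ℕ λ j → (1 ≤ j) × (j ≤ t) × B j × (∀ k → suc j ≤ k → k ≤ t → A k)

Since-zero : ∀ {A B} → ¬ Since A B 0
Since-zero (zero , () , _)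
Since-zero (suc _ , _ , () , _)

Since-unfold : ∀ {A B : ℕ → Set} t → Since A B (suc t) ⇔ (B (suc t) ⊎ (A (suc t) × Since A B t))
Since-unfold {A} {B} t = mk⇔ unfold fold
  where
  unfold : Since A B (suc t) → B (suc t) ⊎ (A (suc t) × Since A B t)
  unfold (j , 1≤j , j≤1+t , Bj , A*) with m≤n⇒m<n∨m≡n j≤1+t
  ... | inj₂ refl = inj₁ Bj
  ... | inj₁ (s≤s j≤t) =
    inj₂ (A* (suc t) (s≤s j≤t) ≤-refl , j , 1≤j , j≤t , Bj , λ k j<k k≤t → A* k j<k (m≤n⇒m≤1+n k≤t))
  fold : B (suc t) ⊎ (A (suc t) × Since A B t) → Since A B (suc t)
  fold (inj₁ B1+t) =
    suc t , s≤s z≤n , ≤-refl , B1+t , λ k 1+t<k k≤1+t → ⊥-elim (<-irrefl refl (<-≤-trans 1+t<k k≤1+t))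
  fold (inj₂ (A1+t , j , 1≤j , j≤t , Bj , A*)) = j , 1≤j , m≤n⇒m≤1+n j≤t , Bj , A*′
    where
    A*′ : ∀ k → suc j ≤ k → k ≤ suc t → A k
    A*′ k j<k k≤1+t with m≤n⇒m<n∨m≡n k≤1+t
    ... | inj₁ (s≤s k≤t) = A* k j<k k≤t
    ... | inj₂ refl = A1+t

Since-map : ∀ {A A′ B B′ : ℕ → Set} → (∀ k → A (suc k) → A′ (suc k)) → (∀ k → B (suc k) → B′ (suc k)) →
            ∀ {t} → Since A B t → Since A′ B′ t
Since-map f g (zero , () , _)
Since-map {A′ = A′} f g {t} (suc j , 1≤j , j≤t , Bj , A*) = suc j , 1≤j , j≤t , g j Bj , A*′
  where
  A*′ : ∀ k → suc (suc j) ≤ k → k ≤ t → A′ k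
  A*′ (suc k) j<k k≤t = f k (A* (suc k) j<k k≤t)

Since-cong : ∀ {A A′ B B′ : ℕ → Set} → (∀ k → A (suc k) ⇔ A′ (suc k)) → (∀ k → B (suc k) ⇔ B′ (suc k)) →
             ∀ t → Since A B t ⇔ Since A′ B′ t
Since-cong A⇔ B⇔ t = mk⇔ (Since-map (to ∘ A⇔) (to ∘ B⇔)) (Since-map (from ∘ A⇔) (from ∘ B⇔))

Trace : Set
Trace = ℕ → Var → Bool

_,_⊨ᵗ_ : Trace → ℕ → Formula → Set
M , zero  ⊨ᵗ φ = ⊥
M , suc t ⊨ᵗ var x    = M (suc t) x ≡ true
M , suc t ⊨ᵗ tt       = ⊤
M , suc t ⊨ᵗ ff       = ⊥
M , suc t ⊨ᵗ (¬ᶠ α)   = ¬ (M , suc t ⊨ᵗ α)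
M , suc t ⊨ᵗ (α ∧ᶠ β) = (M , suc t ⊨ᵗ α) × (M , suc t ⊨ᵗ β)
M , suc t ⊨ᵗ (α ∨ᶠ β) = (M , suc t ⊨ᵗ α) ⊎ (M , suc t ⊨ᵗ β)
M , suc t ⊨ᵗ (⊖ α)    = M , t ⊨ᵗ α
M , suc t ⊨ᵗ (α Sᶠ β) = Since (λ k → M , k ⊨ᵗ α) (λ k → M , k ⊨ᵗ β) (suc t)

Agree : Trace → Interp → Var → Set
Agree M I x = ∀ t → M (suc t) x ≡ at I (suc t) x

⊨ᵗ⇔⊨ : ∀ {M I} φ → All (Agree M I) (fvars φ) → ∀ t → (M , t ⊨ᵗ φ) ⇔ (I , t ⊨ φ)
⊨ᵗ⇔⊨ φ        agree        zero    = ⇔-id ⊥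
⊨ᵗ⇔⊨ (var x)  (agree ∷ []) (suc t) = mk⇔ (trans (sym (agree t))) (trans (agree t))
⊨ᵗ⇔⊨ tt       agree (suc t) = ⇔-id ⊤
⊨ᵗ⇔⊨ ff       agree (suc t) = ⇔-id ⊥
⊨ᵗ⇔⊨ (¬ᶠ α)   agree (suc t) = ¬-cong-⇔ (⊨ᵗ⇔⊨ α agree (suc t))
⊨ᵗ⇔⊨ (α ∧ᶠ β) agree (suc t) =
  ⊨ᵗ⇔⊨ α (All.++⁻ˡ (fvars α) agree) (suc t) ×-⇔ ⊨ᵗ⇔⊨ β (All.++⁻ʳ (fvars α) agree) (suc t)
⊨ᵗ⇔⊨ (α ∨ᶠ β) agree (suc t) =
  ⊨ᵗ⇔⊨ α (All.++⁻ˡ (fvars α) agree) (suc t) ⊎-⇔ ⊨ᵗ⇔⊨ β (All.++⁻ʳ (fvars α) agree) (suc t)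
⊨ᵗ⇔⊨ (⊖ α)    agree (suc t) = ⊨ᵗ⇔⊨ α agree t
⊨ᵗ⇔⊨ (α Sᶠ β) agree (suc t) =
  Since-cong (⊨ᵗ⇔⊨ α (All.++⁻ˡ (fvars α) agree) ∘ suc) (⊨ᵗ⇔⊨ β (All.++⁻ʳ (fvars α) agree) ∘ suc) (suc t)

module _ {n : ℕ} (δ : Fin n → Bool → Bool → Fin n) (q₀ : Fin n) where

  run : (ℕ → Bool) → (ℕ → Bool) → ℕ → Fin n
  run a b zero    = q₀
  run a b (suc t) = δ (run a b t) (a (suc t)) (b (suc t))

  indicators-track-run : ∀ {a b} (s : ℕ → Fin n → Bool) →
    (∀ i → s 0 i ≡ true ⇔ q₀ ≡ i) →
    (∀ t i → s (suc t) i ≡ true ⇔ (Σ (Fin n) λ j → δ j (a (suc t)) (b (suc t)) ≡ i × s t j ≡ true)) →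
    ∀ t i → s t i ≡ true ⇔ run a b t ≡ i
  indicators-track-run s init step zero i = init i
  indicators-track-run {a} {b} s init step (suc t) i = mk⇔
    (λ sᵢ → let j , δj≡i , sⱼ = to (step t i) sᵢ in subst (λ q → δ q _ _ ≡ i) (sym (to (ih j) sⱼ)) δj≡i)
    (λ δ≡i → from (step t i) (run a b t , δ≡i , from (ih (run a b t)) refl))
    where
    ih = indicators-track-run s init step t

δS≡suc-zero⇔ : ∀ q x y → δS q x y ≡ suc zero ⇔ (y ≡ true ⊎ (x ≡ true × q ≡ suc zero))
δS≡suc-zero⇔ q true  false = mk⇔ (λ q≡1 → inj₂ (refl , q≡1)) λ { (inj₁ ()) ; (inj₂ (_ , q≡1)) → q≡1 }
δS≡suc-zero⇔ q false true  = mk⇔ (λ _ → inj₁ refl) (λ _ → refl)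
δS≡suc-zero⇔ q true  true  = mk⇔ (λ _ → inj₁ refl) (λ _ → refl)
δS≡suc-zero⇔ q false false = mk⇔ (λ ()) λ { (inj₁ ()) ; (inj₂ (() , _)) }

runS≡suc-zero⇔Since : ∀ a b t →
  run δS qinit a b t ≡ suc zero ⇔ Since (λ k → a k ≡ true) (λ k → b k ≡ true) t
runS≡suc-zero⇔Since a b zero    = mk⇔ (λ ()) (⊥-elim ∘ Since-zero)
runS≡suc-zero⇔Since a b (suc t) = begin
  run δS qinit a b (suc t) ≡ suc zero
    ∼⟨ δS≡suc-zero⇔ (run δS qinit a b t) (a (suc t)) (b (suc t)) ⟩
  (b (suc t) ≡ true ⊎ (a (suc t) ≡ true × run δS qinit a b t ≡ suc zero))
    ∼⟨ ⇔-id _ ⊎-⇔ (⇔-id _ ×-⇔ runS≡suc-zero⇔Since a b t) ⟩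
  (b (suc t) ≡ true ⊎ (a (suc t) ≡ true × Since (λ k → a k ≡ true) (λ k → b k ≡ true) t))
    ∼⟨ ⇔-sym (Since-unfold t) ⟩
  Since (λ k → a k ≡ true) (λ k → b k ≡ true) (suc t) ∎
  where open EquationalReasoning

≡zero⇔≢suc-zero : (q : Fin 2) → q ≡ zero ⇔ (¬ q ≡ suc zero)
≡zero⇔≢suc-zero zero       = mk⇔ (λ _ ()) (λ _ → refl)
≡zero⇔≢suc-zero (suc zero) = mk⇔ (λ ()) (λ q≢1 → ⊥-elim (q≢1 refl))

module _ {A : Set} where

  ∈-─⁻ : ∀ {x y : A} {xs} (x∈xs : x ∈ xs) → y ∈ (xs ─ x∈xs) → y ∈ xs
  ∈-─⁻ (here _)     y∈xs′         = there y∈xs′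
  ∈-─⁻ (there x∈xs) (here y≡)     = here y≡
  ∈-─⁻ (there x∈xs) (there y∈xs′) = there (∈-─⁻ x∈xs y∈xs′)

  ∈⇒≡⊎∈-─ : ∀ {x y : A} {xs} (x∈xs : x ∈ xs) → y ∈ xs → y ≡ x ⊎ y ∈ (xs ─ x∈xs)
  ∈⇒≡⊎∈-─ (here refl)  (here y≡)    = inj₁ y≡
  ∈⇒≡⊎∈-─ (here _)     (there y∈xs) = inj₂ y∈xs
  ∈⇒≡⊎∈-─ (there x∈xs) (here y≡)    = inj₂ (here y≡)
  ∈⇒≡⊎∈-─ (there x∈xs) (there y∈xs) = Sum.map₂ there (∈⇒≡⊎∈-─ x∈xs y∈xs)

psize-─ : ∀ {r Q} (r∈Q : r ∈ Q) → psize Q ≡ rsize r + psize (Q ─ r∈Q)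
psize-─ (here refl) = refl
psize-─ {r} {r′ ∷ Q} (there r∈Q) =
  trans (cong (rsize r′ +_) (psize-─ r∈Q)) (x∙yz≈y∙xz (rsize r′) (rsize r) (psize (Q ─ r∈Q)))

Star⇒TransClosure : ∀ {A : Set} {R : A → A → Set} {x y z} → Star R x y → R y z → TransClosure R x z
Star⇒TransClosure ε          y∼z = [ y∼z ]
Star⇒TransClosure (x∼w ◅ w⇝y) y∼z = x∼w ∷ Star⇒TransClosure w⇝y y∼z

k+≤[k+m]* : ∀ k {m F C} → 1 ≤ C → F ≤ m * C → k + F ≤ (k + m) * C
k+≤[k+m]* k {m} {F} {C} 1≤C F≤mC = begin
  k + F         ≤⟨ +-mono-≤ (≤-trans (≤-reflexive (sym (*-identityʳ k))) (*-monoʳ-≤ k 1≤C)) F≤mC ⟩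
  k * C + m * C ≡⟨ sym (*-distribʳ-+ C k m) ⟩
  (k + m) * C   ∎
  where open ≤-Reasoning

n<4^n : ∀ n → n < 4 ^ n
n<4^n zero    = s≤s z≤n
n<4^n (suc n) = begin-strict
  suc n           <⟨ +-monoˡ-≤ (suc n) (m^n>0 4 n) ⟩
  4 ^ n + suc n   ≤⟨ +-monoʳ-≤ (4 ^ n) (n<4^n n) ⟩
  4 ^ n + 4 ^ n   ≤⟨ +-monoʳ-≤ (4 ^ n) (m≤m+n (4 ^ n) _) ⟩
  4 * 4 ^ n       ∎
  where open ≤-Reasoning

¬S-size : ∀ {C} α β → 1 ≤ C → fsize α ≤ C → fsize β ≤ C → fsize (¬ᶠ (α Sᶠ β)) ≤ 4 ^ 4 * C
¬S-size {C} α β 1≤C α≤C β≤C = begin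
  2 + (fsize α + fsize β) ≤⟨ k+≤[k+m]* 2 {2} 1≤C (+-mono-≤ α≤C (≤-trans β≤C (m≤m+n C 0))) ⟩
  4 * C                   ≤⟨ *-monoˡ-≤ C (m≤m+n 4 252) ⟩
  4 ^ 4 * C               ∎
  where open ≤-Reasoning

instantiate : (Var → Formula) → SFormula → Formula
instantiate c (var x)  = c x
instantiate c tt       = tt
instantiate c ff       = ff
instantiate c (¬ˢ α)   = ¬ᶠ instantiate c α
instantiate c (α ∧ˢ β) = instantiate c α ∧ᶠ instantiate c β
instantiate c (α ∨ˢ β) = instantiate c α ∨ᶠ instantiate c β

instantiate-sound : ∀ {M t v} c α → (∀ x → v x ≡ true ⇔ (M , suc t ⊨ᵗ c x)) →
                    ⟦ α ⟧ˢ v ⇔ (M , suc t ⊨ᵗ instantiate c α)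
instantiate-sound c (var x)  c⇔ = c⇔ x
instantiate-sound c tt       c⇔ = ⇔-id ⊤
instantiate-sound c ff       c⇔ = ⇔-id ⊥
instantiate-sound c (¬ˢ α)   c⇔ = ¬-cong-⇔ (instantiate-sound c α c⇔)
instantiate-sound c (α ∧ˢ β) c⇔ = instantiate-sound c α c⇔ ×-⇔ instantiate-sound c β c⇔
instantiate-sound c (α ∨ˢ β) c⇔ = instantiate-sound c α c⇔ ⊎-⇔ instantiate-sound c β c⇔

instantiate-All : ∀ {X : Var → Set} c α → (∀ {x} → x ∈ svars α → All X (fvars (c x))) →
                  All X (fvars (instantiate c α))
instantiate-All c (var x)  allᶜ = allᶜ (here refl)
instantiate-All c tt       allᶜ = []
instantiate-All c ff       allᶜ = []
instantiate-All c (¬ˢ α)   allᶜ = instantiate-All c α allᶜ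
instantiate-All c (α ∧ˢ β) allᶜ =
  All.++⁺ (instantiate-All c α (allᶜ ∘ Any.++⁺ˡ)) (instantiate-All c β (allᶜ ∘ Any.++⁺ʳ (svars α)))
instantiate-All c (α ∨ˢ β) allᶜ =
  All.++⁺ (instantiate-All c α (allᶜ ∘ Any.++⁺ˡ)) (instantiate-All c β (allᶜ ∘ Any.++⁺ʳ (svars α)))

instantiate-size : ∀ {C} c α → 1 ≤ C → (∀ x → fsize (c x) ≤ C) → fsize (instantiate c α) ≤ ssize α * C
instantiate-size c (var x)  1≤C c≤C = ≤-trans (c≤C x) (m≤m+n _ 0)
instantiate-size c tt       1≤C c≤C = ≤-trans 1≤C (m≤m+n _ 0)
instantiate-size c ff       1≤C c≤C = ≤-trans 1≤C (m≤m+n _ 0)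
instantiate-size c (¬ˢ α)   1≤C c≤C = +-mono-≤ 1≤C (instantiate-size c α 1≤C c≤C)
instantiate-size {C} c (α ∧ˢ β) 1≤C c≤C = +-mono-≤ 1≤C (≤-trans
  (+-mono-≤ (instantiate-size c α 1≤C c≤C) (instantiate-size c β 1≤C c≤C))
  (≤-reflexive (sym (*-distribʳ-+ C (ssize α) (ssize β)))))
instantiate-size {C} c (α ∨ˢ β) 1≤C c≤C = +-mono-≤ 1≤C (≤-trans
  (+-mono-≤ (instantiate-size c α 1≤C c≤C) (instantiate-size c β 1≤C c≤C))
  (≤-reflexive (sym (*-distribʳ-+ C (ssize α) (ssize β)))))

fromBool : Bool → Formula
fromBool true  = tt
fromBool false = ff

fromBool-sound : ∀ {M t} b → b ≡ true ⇔ (M , suc t ⊨ᵗ fromBool b)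
fromBool-sound true  = mk⇔ _ (λ _ → refl)
fromBool-sound false = mk⇔ (λ ()) (λ ())

fsize-fromBool : ∀ b → fsize (fromBool b) ≡ 1
fsize-fromBool true  = refl
fsize-fromBool false = refl

first : Formula
first = ¬ᶠ (⊖ tt)

HeadOfState : Fin 2 → Rule → Var → Set
HeadOfState i (dynamic ps _ _) q = ps i ≡ q
HeadOfState i (static _ _)     q = ⊥
HeadOfState i (delay _ _)      q = ⊥

headOfState? : ∀ i r q → Dec (HeadOfState i r q)
headOfState? i (dynamic ps _ _) q = ps i ≟ q
headOfState? i (static _ _)     q = no λ ()
headOfState? i (delay _ _)      q = no λ ()

initialValue : Program → Var → Bool
initialValue P q = ⌊ any? (λ r → headOfState? qinit r q) P ⌋

definingRule? : ∀ x Q → Dec (∃ λ r → r ∈ Q × x ∈ heads r)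
definingRule? x Q = map′ find (λ (r , r∈Q , x∈r) → lose r∈Q x∈r) (any? (λ r → x ∈? heads r) Q)

module Unfolding (P : Program) where

  ruleFormula : ∀ {x} (r : Rule) → x ∈ heads r → (Var → Formula) → Formula
  ruleFormula (static _ α)     (here refl)         c = instantiate c α
  ruleFormula (delay _ q)      (here refl)         c = (⊖ c q) ∨ᶠ (first ∧ᶠ fromBool (initialValue P q))
  ruleFormula (dynamic _ a b)  (here refl)         c = ¬ᶠ (c a Sᶠ c b)
  ruleFormula (dynamic _ a b)  (there (here refl)) c = c a Sᶠ c b

  unfold : ℕ → Program → Var → Formula
  unfold zero    Q x = var x
  unfold (suc n) Q x with definingRule? x Q
  ... | no _                 = var x
  ... | yes (r , r∈Q , x∈r) = ruleFormula r x∈r (unfold n (Q ─ r∈Q))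

  ruleFormula-All : ∀ {X : Var → Set} {x} r (x∈r : x ∈ heads r) c →
                    (∀ {y} → y ∈ body r → All X (fvars (c y))) → All X (fvars (ruleFormula r x∈r c))
  ruleFormula-All (static _ α)    (here refl)         c allᶜ = instantiate-All c α allᶜ
  ruleFormula-All (delay _ q)     (here refl)         c allᶜ with initialValue P q
  ... | true  = All.++⁺ (allᶜ (here refl)) []
  ... | false = All.++⁺ (allᶜ (here refl)) []
  ruleFormula-All (dynamic _ a b) (here refl)         c allᶜ = All.++⁺ (allᶜ (here refl)) (allᶜ (there (here refl)))
  ruleFormula-All (dynamic _ a b) (there (here refl)) c allᶜ = All.++⁺ (allᶜ (here refl)) (allᶜ (there (here refl)))

  ruleFormula-size : ∀ {x C} r (x∈r : x ∈ heads r) c → 1 ≤ C → (∀ y → fsize (c y) ≤ C) →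
                     fsize (ruleFormula r x∈r c) ≤ 4 ^ rsize r * C
  ruleFormula-size {C = C} (static _ α) (here refl) c 1≤C c≤C = begin
    fsize (instantiate c α)   ≤⟨ instantiate-size c α 1≤C c≤C ⟩
    ssize α * C               ≤⟨ *-monoˡ-≤ C (≤-trans (<⇒≤ (n<4^n (ssize α))) (m≤n*m (4 ^ ssize α) 4)) ⟩
    4 ^ suc (ssize α) * C     ∎
    where open ≤-Reasoning
  ruleFormula-size {C = C} (delay _ q) (here refl) c 1≤C c≤C = begin
    2 + (fsize (c q) + (4 + fsize (fromBool (initialValue P q))))
      ≡⟨ cong (λ s → 2 + (fsize (c q) + (4 + s))) (fsize-fromBool (initialValue P q)) ⟩
    2 + (fsize (c q) + 5)    ≡⟨ cong (2 +_) (+-comm (fsize (c q)) 5) ⟩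
    7 + fsize (c q)          ≤⟨ k+≤[k+m]* 7 {1} 1≤C (≤-trans (c≤C q) (m≤m+n C 0)) ⟩
    8 * C                    ≤⟨ *-monoˡ-≤ C (m≤m+n 8 8) ⟩
    4 ^ 2 * C                ∎
    where open ≤-Reasoning
  ruleFormula-size (dynamic _ a b) (here refl)         c 1≤C c≤C = ¬S-size (c a) (c b) 1≤C (c≤C a) (c≤C b)
  ruleFormula-size (dynamic _ a b) (there (here refl)) c 1≤C c≤C =
    ≤-trans (n≤1+n _) (¬S-size (c a) (c b) 1≤C (c≤C a) (c≤C b))

  unfold-size : ∀ n Q y → fsize (unfold n Q y) ≤ 4 ^ suc (psize Q)
  unfold-size zero    Q y = m^n>0 4 (suc (psize Q))
  unfold-size (suc n) Q y with definingRule? y Q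
  ... | no _                 = m^n>0 4 (suc (psize Q))
  ... | yes (r , r∈Q , y∈r) = begin
    fsize (ruleFormula r y∈r (unfold n Q′))
      ≤⟨ ruleFormula-size r y∈r (unfold n Q′) (m^n>0 4 (suc (psize Q′))) (unfold-size n Q′) ⟩
    4 ^ rsize r * 4 ^ suc (psize Q′) ≡⟨ sym (^-distribˡ-+-* 4 (rsize r) (suc (psize Q′))) ⟩
    4 ^ (rsize r + suc (psize Q′))   ≡⟨ cong (4 ^_) (+-suc (rsize r) (psize Q′)) ⟩
    4 ^ suc (rsize r + psize Q′)     ≡⟨ cong (λ s → 4 ^ suc s) (psize-─ r∈Q) ⟨
    4 ^ suc (psize Q)                ∎
    where
    Q′ = Q ─ r∈Q
    open ≤-Reasoning

definingRule∈ : ∀ {x} P → x ∈ allHeads P → ∃ λ r → r ∈ P × x ∈ heads r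
definingRule∈ P x∈heads = find (Any.map⁻ (∈-concat⁻ (map heads P) x∈heads))

module Inputs (P : Program) (nonRecursive : NonRecursive P) where
  open Unfolding P

  -- Every rule already removed from Q during the unfolding of y has a body variable
  -- reachable from y, so y cannot be defined by it without closing a cycle.
  Accounted : Var → Program → Set
  Accounted y Q = ∀ {r} → r ∈ P → r ∈ Q ⊎ ∃ λ b → b ∈ body r × Star (Edge P) y b

  undefined⇒input : ∀ {y Q} → ¬ (∃ λ r → r ∈ Q × y ∈ heads r) → Accounted y Q → Input P y
  undefined⇒input {y} undefined accounted y∈heads with definingRule∈ P y∈heads
  ... | r , r∈P , y∈r with accounted r∈P
  ...   | inj₁ r∈Q              = undefined (r , r∈Q , y∈r)
  ...   | inj₂ (b , b∈r , y⇝b) = nonRecursive y (Star⇒TransClosure y⇝b (r , r∈P , b∈r , y∈r))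

  unfold-inputs : ∀ n Q y → length Q ≤ n → Q ⊆ P → Accounted y Q → All (Input P) (fvars (unfold n Q y))
  unfold-inputs zero [] y _ _ accounted = undefined⇒input (λ { (_ , () , _) }) accounted ∷ []
  unfold-inputs (suc n) Q y len≤ Q⊆P accounted with definingRule? y Q
  ... | no undefined         = undefined⇒input undefined accounted ∷ []
  ... | yes (r , r∈Q , y∈r) =
    ruleFormula-All r y∈r (unfold n Q′) λ v∈r →
      unfold-inputs n Q′ _ len′≤ (Q⊆P ∘ ∈-─⁻ r∈Q) (accounted′ v∈r)
    where
    Q′ = Q ─ r∈Q
    len′≤ : length Q′ ≤ n
    len′≤ = ≤-pred (subst (_≤ suc n) (length-removeAt′ Q (index r∈Q)) len≤)
    accounted′ : ∀ {v} → v ∈ body r → Accounted v Q′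
    accounted′ {v} v∈r r′∈P with accounted r′∈P
    ... | inj₂ (b , b∈r′ , y⇝b) = inj₂ (b , b∈r′ , (r , Q⊆P r∈Q , v∈r , y∈r) ◅ y⇝b)
    ... | inj₁ r′∈Q with ∈⇒≡⊎∈-─ r∈Q r′∈Q
    ...   | inj₁ refl  = inj₂ (v , v∈r , ε)
    ...   | inj₂ r′∈Q′ = inj₁ r′∈Q′

module Soundness {P I M} (S : IsSemantics P I M) where
  open IsSemantics S
  open Unfolding P

  headOfState-at-0 : ∀ i {r q} → r ∈ P → HeadOfState i r q → M 0 q ≡ true ⇔ qinit ≡ i
  headOfState-at-0 i {dynamic ps a b} r∈P refl = time0-dyn ps a b r∈P i

  initialValue-sound : ∀ q → M 0 q ≡ initialValue P q
  initialValue-sound q with any? (λ r → headOfState? qinit r q) P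
  ... | yes initial = let _ , r∈P , head = find initial in from (headOfState-at-0 qinit r∈P head) refl
  ... | no ¬initial with any? (λ r → headOfState? (suc zero) r q) P
  ...   | yes second = let _ , r∈P , head = find second in
                       ¬-not ((λ ()) ∘ to (headOfState-at-0 (suc zero) r∈P head))
  ...   | no ¬second = time0-other q λ where
    ps a b zero       r∈P head → ¬initial (lose r∈P head)
    ps a b (suc zero) r∈P head → ¬second (lose r∈P head)

  module _ {ps a b} (r∈P : dynamic ps a b ∈ P) where

    state-sound : ∀ t i → M t (ps i) ≡ true ⇔ run δS qinit (λ k → M k a) (λ k → M k b) t ≡ i
    state-sound = indicators-track-run δS qinit (λ t i → M t (ps i)) (time0-dyn ps a b r∈P)
                                      (λ t → dyn-rule t ps a b r∈P)

    run-sound : (c : Var → Formula) → (∀ v t → M (suc t) v ≡ true ⇔ (M , suc t ⊨ᵗ c v)) →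
                ∀ t → run δS qinit (λ k → M k a) (λ k → M k b) (suc t) ≡ suc zero ⇔ (M , suc t ⊨ᵗ (c a Sᶠ c b))
    run-sound c c⇔ t =
      Since-cong (c⇔ a) (c⇔ b) (suc t) ⇔-∘ runS≡suc-zero⇔Since (λ k → M k a) (λ k → M k b) (suc t)

  ruleFormula-sound : ∀ {r x} → r ∈ P → (x∈r : x ∈ heads r) → (c : Var → Formula) →
                      (∀ v t → M (suc t) v ≡ true ⇔ (M , suc t ⊨ᵗ c v)) →
                      ∀ t → M (suc t) x ≡ true ⇔ (M , suc t ⊨ᵗ ruleFormula r x∈r c)
  ruleFormula-sound {static p α} r∈P (here refl) c c⇔ t =
    instantiate-sound c α (λ v → c⇔ v t) ⇔-∘ static-rule t p α r∈P
  ruleFormula-sound {delay p q} r∈P (here refl) c c⇔ zero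
    rewrite delay-rule 0 p q r∈P | initialValue-sound q =
    mk⇔ (λ initial → inj₂ ((λ ()) , to (fromBool-sound (initialValue P q)) initial))
        (λ { (inj₁ ()) ; (inj₂ (_ , initial)) → from (fromBool-sound (initialValue P q)) initial })
  ruleFormula-sound {delay p q} r∈P (here refl) c c⇔ (suc t)
    rewrite delay-rule (suc t) p q r∈P =
    mk⇔ (inj₁ ∘ to (c⇔ q t)) λ { (inj₁ previous) → from (c⇔ q t) previous ; (inj₂ (¬⊤ , _)) → ⊥-elim (¬⊤ _) }
  ruleFormula-sound {dynamic ps a b} r∈P (here refl) c c⇔ t = begin
    M (suc t) (ps zero) ≡ true        ∼⟨ state-sound r∈P (suc t) zero ⟩
    run′ ≡ zero                       ∼⟨ ≡zero⇔≢suc-zero run′ ⟩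
    (¬ run′ ≡ suc zero)               ∼⟨ ¬-cong-⇔ (run-sound r∈P c c⇔ t) ⟩
    (¬ (M , suc t ⊨ᵗ (c a Sᶠ c b)))   ∎
    where
    run′ = run δS qinit (λ k → M k a) (λ k → M k b) (suc t)
    open EquationalReasoning
  ruleFormula-sound {dynamic ps a b} r∈P (there (here refl)) c c⇔ t =
    run-sound r∈P c c⇔ t ⇔-∘ state-sound r∈P (suc t) (suc zero)

  unfold-sound : ∀ n Q → Q ⊆ P → ∀ x t → M (suc t) x ≡ true ⇔ (M , suc t ⊨ᵗ unfold n Q x)
  unfold-sound zero    Q Q⊆P x t = ⇔-id _
  unfold-sound (suc n) Q Q⊆P x t with definingRule? x Q
  ... | no _                 = ⇔-id _
  ... | yes (r , r∈Q , x∈r) =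
    ruleFormula-sound (Q⊆P r∈Q) x∈r (unfold n (Q ─ r∈Q)) (unfold-sound n (Q ─ r∈Q) (Q⊆P ∘ ∈-─⁻ r∈Q)) t

theorem12 : Σ ℕ λ c → ∀ (P : Program) → ValidProgram P → ∀ a → a ∈ vars P →
    Σ Formula λ φ → All (Input P) (fvars φ) × fsize φ ≤ 2 ^ (c * suc (psize P)) ×
      (∀ (I : Interp) → NonEmpty I → ∀ M → IsSemantics P I M →
        ∀ t → 1 ≤ t → t ≤ length I → (M t a ≡ true) ⇔ (I , t ⊨ φ))
theorem12 = 2 , λ P (nonRecursive , _) a _ →
  let open Unfolding P
      φ      = unfold (length P) P a
      inputs = Inputs.unfold-inputs P nonRecursive (length P) P a ≤-refl id inj₁
  in φ
   , inputs
   , subst (fsize φ ≤_) (^-*-assoc 2 2 (suc (psize P))) (unfold-size (length P) P a)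
   , λ { I _ M S zero () _
       ; I _ M S (suc t) _ _ →
           ⊨ᵗ⇔⊨ φ (All.map (λ input t → IsSemantics.input S t _ input) inputs) (suc t)
             ⇔-∘ Soundness.unfold-sound S (length P) P id a t }
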